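{- Let $k,t,r$ be integers with $t>r>2$, $k=\binom{t-1}{r-1}$ and $kr\geq 2t$. Let $n,l$ be integers with $n=l+pt$ for some integer $p\geq 0$ and $l\geq 2t+2$, and put $a=\lceil l/2\rceil$, $b=\lfloor l/2\rfloor$. Let $H_0$ be the $r$-uniform hypergraph obtained from vertex-disjoint copies $A\cong K_a^r$ and $B\cong K_b^r$ by adding $k$ distinct new edges, each an $r$-subset of $V(A)\cup V(B)$ meeting both $V(A)$ and $V(B)$. Let $H$ be obtained from $H_0$ by adding $p$ vertex-disjoint copies $S_1,\dots,S_p$ of $K_t^r$ (disjoint from $H_0$) and, for each $j$, $k$ distinct new edges, each an $r$-subset of $V(S_j)\cup V(H_0)$ meeting both $V(S_j)$ and $V(H_0)$, such that (i) every vertex of $S_j$ lies in at least one of these $k$ edges, and (ii) at least one of these $k$ edges meets $V(A)$ and at least one of them meets $V(B)$. Then $H$ is a $(k,l)$-edge-maximal $r$-uniform hypergraph.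
   Context: A hypergraph $H=(V,E)$ has a finite vertex set $V$ and a set $E$ of nonempty subsets of $V$ (edges); it is $r$-uniform if every edge has exactly $r$ elements. $K_m^r$ denotes the complete $r$-uniform hypergraph on $m$ vertices. A subhypergraph $H'=(V',E')$ of $H$ has $V'\subseteq V$, $E'\subseteq E$ (with each edge of $E'$ contained in $V'$). For $X\subseteq V$, $d_H(X)$ is the number of edges meeting both $X$ and $V\setminus X$; $\kappa'(H)=\min\{d_H(X):\emptyset\neq X\subsetneq V\}$. For an $r$-subset $e\notin E$ of $V$, $H+e=(V,E\cup\{e\})$. An $r$-uniform hypergraph $H$ is $(k,l)$-edge-maximal if every subhypergraph $H'$ with $|V(H')|\geq l$ has $\kappa'(H')\leq k$, but for every $r$-subset $e$ of $V(H)$ not in $E(H)$, $H+e$ has a subhypergraph $H''$ with $|V(H'')|\geq l$ and $\kappa'(H'')\geq k+1$. -}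

module Defs where

open import Data.Nat using (ℕ; zero; suc; _≤_)
open import Data.Bool using (Bool; true; false; _∧_; _∨_; if_then_else_)
open import Data.Bool.Properties using () renaming (_≟_ to _≟ᵇ_)
open import Data.List using (List; []; _∷_; _++_; map; length; filterᵇ)
open import Data.Vec using (Vec; []; _∷_; foldr′)
open import Data.Vec.Properties using (≡-dec)
open import Data.Fin using (Fin)
open import Data.Fin.Subset using (Subset; _∩_; _─_; _⊆_; Nonempty; ∣_∣)
open import Data.Product using (Σ; _×_; ∃)
open import Relation.Binary.PropositionalEquality using (_≡_)
open import Relation.Nullary.Decidable using (⌊_⌋)

-- An r-uniform hypergraph on the vertex set Fin n is given by the
-- characteristic function of its edge set (edges are subsets of Fin n).
Edges : ℕ → Set
Edges n = Subset n → Bool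

_∈E_ : ∀ {n} → Subset n → Edges n → Set
e ∈E E = E e ≡ true

Uniform : ∀ {n} → ℕ → Edges n → Set
Uniform r E = ∀ e → e ∈E E → ∣ e ∣ ≡ r

_+E_ : ∀ {n} → Edges n → Subset n → Edges n
(E +E e) x = E x ∨ ⌊ ≡-dec _≟ᵇ_ x e ⌋

IsSub : ∀ {n} → Edges n → Subset n → Edges n → Set
IsSub E V' E' = ∀ e → e ∈E E' → (e ∈E E) × (e ⊆ V')

allSubsets : (n : ℕ) → List (Subset n)
allSubsets zero = [] ∷ []
allSubsets (suc n) = map (true ∷_) (allSubsets n) ++ map (false ∷_) (allSubsets n)

anyᵇ : ∀ {n} → Subset n → Bool
anyᵇ = foldr′ _∨_ false

meetsᵇ : ∀ {n} → Subset n → Subset n → Bool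
meetsᵇ e X = anyᵇ (e ∩ X)

d : ∀ {n} → Subset n → Edges n → Subset n → ℕ
d {n} V' E' X =
  length (filterᵇ (λ e → E' e ∧ (meetsᵇ e X ∧ meetsᵇ e (V' ─ X))) (allSubsets n))

ProperNonempty : ∀ {n} → Subset n → Subset n → Set
ProperNonempty V' X = X ⊆ V' × Nonempty X × Nonempty (V' ─ X)

-- κ'(H') ≤ m  (κ' is the minimum of d over ∅ ≠ X ⊊ V')
κ'≤ : ∀ {n} → Subset n → Edges n → ℕ → Set
κ'≤ V' E' m = ∃ λ X → ProperNonempty V' X × d V' E' X ≤ m

κ'≥ : ∀ {n} → Subset n → Edges n → ℕ → Set
κ'≥ V' E' m = ∀ X → ProperNonempty V' X → m ≤ d V' E' X

EdgeMaximal : ∀ {n} → ℕ → ℕ → ℕ → Edges n → Set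
EdgeMaximal {n} r k l E =
  Uniform r E ×
  (∀ V' E' → IsSub E V' E' → l ≤ ∣ V' ∣ → κ'≤ V' E' k) ×
  (∀ e → ∣ e ∣ ≡ r → E e ≡ false →
     ∃ λ V'' → ∃ λ E'' → IsSub (E +E e) V'' E'' × l ≤ ∣ V'' ∣ × κ'≥ V'' E'' (suc k))

-- A subhypergraph on at least l vertices either meets some S_j, and then its part inside S_j is a
-- proper cut crossed only by the k edges attaching S_j, or it lies in A ∪ B, and then its part in A
-- is crossed only by the k edges between A and B; hence κ′ ≤ k.
-- For a non-edge e, keep A ∪ B and the copies S_j met by e. A cut splitting a complete block on m
-- vertices is crossed by at least C(m − 1, r − 1) of the block's edges: more than k for A and B, since
-- m > t, and k for S_j, where in addition an attaching edge or an A–B edge leaves S_j across the cut.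
-- If no block is split, the k edges joining two blocks on opposite sides all cross, and e itself,
-- or an edge attaching a copy met by e, supplies one more.
module Submission where

open import Defs
open import Data.Nat using (ℕ; zero; suc; _+_; _*_; _∸_; _≤_; _<_; _≤′_; ≤′-refl; ≤′-step; z≤n; s≤s; ⌈_/2⌉; ⌊_/2⌋)
open import Data.Nat.Combinatorics using (_C_; nCk+nC[k+1]≡[n+1]C[k+1]; k>n⇒nCk≡0)
open import Data.Fin using (Fin; zero; suc; fromℕ<) renaming (_≟_ to _≟ᶠ_)
open import Data.Fin.Subset using (Subset; inside; outside; _∈_; _∉_; _⊆_; _∩_; _∪_; _─_; Nonempty; Empty; ∣_∣)
open import Data.Product using (_×_; ∃; ∃₂; _,_; proj₁; proj₂)
open import Data.Sum using (_⊎_; inj₁; inj₂)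
open import Function.Definitions using (Injective)
open import Function.Bundles using (_⇔_; Equivalence)
open import Relation.Binary.PropositionalEquality
open import Algebra.Properties.CommutativeSemigroup using (interchange)
open import Data.Bool using (Bool; true; false; _∧_; _∨_; not; if_then_else_; T?)
open import Data.Bool.Properties using (∧-conicalˡ; ∧-conicalʳ; ∧-zeroʳ; ∨-zeroʳ) renaming (_≟_ to _≟ᵇ_)
open import Data.Empty using (⊥-elim)
import Data.Fin.Properties as Finₚ
open import Data.Fin.Properties using (any?)
open import Data.Fin.Subset.Properties
  using (_⊆?_; _∈?_; nonempty?; p─q⊆p; p∩q⊆p; p∩q⊆q; p⊆q⇒∣p∣≤∣q∣; x∈p⇒∣p-x∣<∣p∣;
         x∈p∩q⁺; x∈p∩q⁻; x∈p∪q⁺; x∈p∪q⁻; x∈p∧x∉q⇒x∈p─q)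
open import Data.List using (List; []; _∷_; _++_; map; length; filterᵇ)
open import Data.List.Properties using (length-++; filter-++)
open import Data.Nat.Properties
open import Data.Nat.Solver using (module +-*-Solver)
open import Data.Vec using ([]; _∷_; here; there; tabulate)
open import Data.Vec.Properties using (≡-dec; lookup⇒[]=; []=⇒lookup; lookup∘tabulate)
open import Function using (_∘_; case_of_)
open import Relation.Nullary using (Dec; yes; no; ¬_; does)
open import Relation.Nullary.Decidable using (_⊎-dec_; _×-dec_; dec-true; dec-false; isYes≗does)

private
  variable
    n : ℕ

dec-true⁻¹ : ∀ {A : Set} (a? : Dec A) → does a? ≡ true → A
dec-true⁻¹ (yes a) _ = a

subsetOf : {P : Fin n → Set} → (∀ x → Dec (P x)) → Subset n
subsetOf P? = tabulate (does ∘ P?)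

∈-subsetOf⁺ : {P : Fin n → Set} (P? : ∀ x → Dec (P x)) {x : Fin n} → P x → x ∈ subsetOf P?
∈-subsetOf⁺ P? {x} Px = lookup⇒[]= x (subsetOf P?) (trans (lookup∘tabulate (does ∘ P?) x) (dec-true (P? x) Px))

∈-subsetOf⁻ : {P : Fin n → Set} (P? : ∀ x → Dec (P x)) {x : Fin n} → x ∈ subsetOf P? → P x
∈-subsetOf⁻ P? {x} x∈ = dec-true⁻¹ (P? x) (trans (sym (lookup∘tabulate (does ∘ P?) x)) ([]=⇒lookup x∈))

x∈p─q⁻ : ∀ (p q : Subset n) {x} → x ∈ p ─ q → x ∈ p × x ∉ q
x∈p─q⁻ p q x∈p─q = p─q⊆p p q x∈p─q , x∉q q x∈p─q
  where
  x∉q : ∀ {n} {p : Subset n} (q : Subset n) {x} → x ∈ p ─ q → x ∉ q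
  x∉q {p = _ ∷ p} (inside ∷ q)  (there x∈p─q) (there x∈q) = x∉q q x∈p─q x∈q
  x∉q {p = _ ∷ p} (outside ∷ q) (there x∈p─q) (there x∈q) = x∉q q x∈p─q x∈q

x∈p─[p∩q]⁻ : ∀ (p q : Subset n) {x} → x ∈ p ─ (p ∩ q) → x ∈ p × x ∉ q
x∈p─[p∩q]⁻ p q x∈ with x∈p─q⁻ p (p ∩ q) x∈
... | x∈p , x∉p∩q = x∈p , λ x∈q → x∉p∩q (x∈p∩q⁺ (x∈p , x∈q))

Nonempty-∩⁻ : ∀ (p q : Subset n) → Nonempty (p ∩ q) → ∃ λ x → x ∈ p × x ∈ q
Nonempty-∩⁻ p q (x , x∈p∩q) = x , x∈p∩q⁻ p q x∈p∩q

∣p∩q∣+∣p─q∣≡∣p∣ : ∀ (p q : Subset n) → ∣ p ∩ q ∣ + ∣ p ─ q ∣ ≡ ∣ p ∣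
∣p∩q∣+∣p─q∣≡∣p∣ []            []            = refl
∣p∩q∣+∣p─q∣≡∣p∣ (inside ∷ p)  (inside ∷ q)  = cong suc (∣p∩q∣+∣p─q∣≡∣p∣ p q)
∣p∩q∣+∣p─q∣≡∣p∣ (inside ∷ p)  (outside ∷ q) = trans (+-suc _ _) (cong suc (∣p∩q∣+∣p─q∣≡∣p∣ p q))
∣p∩q∣+∣p─q∣≡∣p∣ (outside ∷ p) (inside ∷ q)  = ∣p∩q∣+∣p─q∣≡∣p∣ p q
∣p∩q∣+∣p─q∣≡∣p∣ (outside ∷ p) (outside ∷ q) = ∣p∩q∣+∣p─q∣≡∣p∣ p q

∣p∪q∣≡∣p∣+∣q∣ : ∀ (p q : Subset n) → (∀ x → x ∈ p → x ∉ q) → ∣ p ∪ q ∣ ≡ ∣ p ∣ + ∣ q ∣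
∣p∪q∣≡∣p∣+∣q∣ []            []            _        = refl
∣p∪q∣≡∣p∣+∣q∣ (inside ∷ p)  (inside ∷ q)  disjoint = ⊥-elim (disjoint zero here here)
∣p∪q∣≡∣p∣+∣q∣ (inside ∷ p)  (outside ∷ q) disjoint =
  cong suc (∣p∪q∣≡∣p∣+∣q∣ p q (λ x x∈p x∈q → disjoint (suc x) (there x∈p) (there x∈q)))
∣p∪q∣≡∣p∣+∣q∣ (outside ∷ p) (inside ∷ q)  disjoint =
  trans (cong suc (∣p∪q∣≡∣p∣+∣q∣ p q (λ x x∈p x∈q → disjoint (suc x) (there x∈p) (there x∈q)))) (sym (+-suc _ _))
∣p∪q∣≡∣p∣+∣q∣ (outside ∷ p) (outside ∷ q) disjoint =
  ∣p∪q∣≡∣p∣+∣q∣ p q (λ x x∈p x∈q → disjoint (suc x) (there x∈p) (there x∈q))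

Empty-∩⇒⊆─ : {s Z X : Subset n} → s ⊆ Z → Empty (s ∩ X) → s ⊆ Z ─ X
Empty-∩⇒⊆─ {X = X} s⊆Z s∩X≡∅ {x} x∈s with x ∈? X
... | yes x∈X = ⊥-elim (s∩X≡∅ (x , x∈p∩q⁺ (x∈s , x∈X)))
... | no  x∉X = x∈p∧x∉q⇒x∈p─q (s⊆Z x∈s) x∉X

Empty-─⇒⊆∩ : {s Z X : Subset n} → s ⊆ Z → Empty (s ─ X) → s ⊆ Z ∩ X
Empty-─⇒⊆∩ {X = X} s⊆Z s─X≡∅ {x} x∈s with x ∈? X
... | yes x∈X = x∈p∩q⁺ (s⊆Z x∈s , x∈X)
... | no  x∉X = ⊥-elim (s─X≡∅ (x , x∈p∧x∉q⇒x∈p─q x∈s x∉X))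

⊆-or-witness : (s Z : Subset n) → s ⊆ Z ⊎ ∃ λ v → v ∈ s × v ∉ Z
⊆-or-witness s Z with nonempty? (s ─ Z)
... | yes (v , v∈s─Z) = inj₂ (v , x∈p─q⁻ s Z v∈s─Z)
... | no  s─Z≡∅       = inj₁ (λ v∈s → p∩q⊆q s Z (Empty-─⇒⊆∩ (λ x → x) s─Z≡∅ v∈s))

∣q∣<∣p∣⇒Nonempty[p─p∩q] : {p q : Subset n} → ∣ q ∣ < ∣ p ∣ → Nonempty (p ─ (p ∩ q))
∣q∣<∣p∣⇒Nonempty[p─p∩q] {p = p} {q} ∣q∣<∣p∣ with ⊆-or-witness p q
... | inj₁ p⊆q = ⊥-elim (<⇒≱ ∣q∣<∣p∣ (p⊆q⇒∣p∣≤∣q∣ p⊆q))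
... | inj₂ (v , v∈p , v∉q) = v , x∈p∧x∉q⇒x∈p─q v∈p (v∉q ∘ p∩q⊆q p q)

Nonempty⇒1≤∣p∣ : {p : Subset n} → Nonempty p → 1 ≤ ∣ p ∣
Nonempty⇒1≤∣p∣ (x , x∈p) = ≤-trans (s≤s z≤n) (x∈p⇒∣p-x∣<∣p∣ x∈p)

anyᵇ⁻ : (p : Subset n) → anyᵇ p ≡ true → Nonempty p
anyᵇ⁻ (inside ∷ p)  _ = zero , here
anyᵇ⁻ (outside ∷ p) h with anyᵇ⁻ p h
... | x , x∈p = suc x , there x∈p

anyᵇ⁺ : (p : Subset n) {x : Fin n} → x ∈ p → anyᵇ p ≡ true
anyᵇ⁺ (inside ∷ p)  _           = refl
anyᵇ⁺ (outside ∷ p) (there x∈p) = anyᵇ⁺ p x∈p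

meetsᵇ⁻ : (s X : Subset n) → meetsᵇ s X ≡ true → ∃ λ x → x ∈ s × x ∈ X
meetsᵇ⁻ s X h with anyᵇ⁻ (s ∩ X) h
... | x , x∈s∩X = x , x∈p∩q⁻ s X x∈s∩X

meetsᵇ⁺ : (s X : Subset n) {x : Fin n} → x ∈ s → x ∈ X → meetsᵇ s X ≡ true
meetsᵇ⁺ s X x∈s x∈X = anyᵇ⁺ (s ∩ X) (x∈p∩q⁺ (x∈s , x∈X))

count : (Subset n → Bool) → ℕ
count {zero}  P = if P [] then 1 else 0
count {suc n} P = count (P ∘ (inside ∷_)) + count (P ∘ (outside ∷_))

length-filterᵇ-map : ∀ {A B : Set} (P : B → Bool) (f : A → B) (xs : List A) →
  length (filterᵇ P (map f xs)) ≡ length (filterᵇ (P ∘ f) xs)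
length-filterᵇ-map P f [] = refl
length-filterᵇ-map P f (x ∷ xs) with P (f x)
... | true  = cong suc (length-filterᵇ-map P f xs)
... | false = length-filterᵇ-map P f xs

length-filterᵇ-allSubsets : ∀ n (P : Subset n → Bool) →
  length (filterᵇ P (allSubsets n)) ≡ count P
length-filterᵇ-allSubsets zero P with P []
... | true  = refl
... | false = refl
length-filterᵇ-allSubsets (suc n) P = begin
  length (filterᵇ P (map (inside ∷_) Sₙ ++ map (outside ∷_) Sₙ))
    ≡⟨ cong length (filter-++ (T? ∘ P) (map (inside ∷_) Sₙ) _) ⟩
  length (filterᵇ P (map (inside ∷_) Sₙ) ++ filterᵇ P (map (outside ∷_) Sₙ))
    ≡⟨ length-++ (filterᵇ P (map (inside ∷_) Sₙ)) ⟩
  length (filterᵇ P (map (inside ∷_) Sₙ)) + length (filterᵇ P (map (outside ∷_) Sₙ))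
    ≡⟨ cong₂ _+_ (length-filterᵇ-map P (inside ∷_) Sₙ) (length-filterᵇ-map P (outside ∷_) Sₙ) ⟩
  length (filterᵇ (P ∘ (inside ∷_)) Sₙ) + length (filterᵇ (P ∘ (outside ∷_)) Sₙ)
    ≡⟨ cong₂ _+_ (length-filterᵇ-allSubsets n _) (length-filterᵇ-allSubsets n _) ⟩
  count P ∎
  where
  open ≡-Reasoning
  Sₙ = allSubsets n

count-cong : {P R : Subset n → Bool} → (∀ s → P s ≡ R s) → count P ≡ count R
count-cong {zero}  P≡R rewrite P≡R [] = refl
count-cong {suc n} P≡R = cong₂ _+_ (count-cong (P≡R ∘ (inside ∷_))) (count-cong (P≡R ∘ (outside ∷_)))

count-mono : {P R : Subset n → Bool} → (∀ s → P s ≡ true → R s ≡ true) → count P ≤ count R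
count-mono {zero} {P} {R} P⇒R with P [] in eq
... | false = z≤n
... | true rewrite P⇒R [] eq = ≤-refl
count-mono {suc n} P⇒R = +-mono-≤ (count-mono (P⇒R ∘ (inside ∷_))) (count-mono (P⇒R ∘ (outside ∷_)))

count-∨+count-∧ : (P R : Subset n → Bool) →
  count (λ s → P s ∨ R s) + count (λ s → P s ∧ R s) ≡ count P + count R
count-∨+count-∧ {zero} P R with P [] | R []
... | true  | true  = refl
... | true  | false = refl
... | false | true  = refl
... | false | false = refl
count-∨+count-∧ {suc n} P R = begin
  (∨ᵢ + ∨ₒ) + (∧ᵢ + ∧ₒ) ≡⟨ interchange +-commutativeSemigroup ∨ᵢ ∨ₒ ∧ᵢ ∧ₒ ⟩
  (∨ᵢ + ∧ᵢ) + (∨ₒ + ∧ₒ) ≡⟨ cong₂ _+_ (count-∨+count-∧ (P ∘ (inside ∷_)) (R ∘ (inside ∷_)))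
                                           (count-∨+count-∧ (P ∘ (outside ∷_)) (R ∘ (outside ∷_))) ⟩
  (Pᵢ + Rᵢ) + (Pₒ + Rₒ) ≡⟨ interchange +-commutativeSemigroup Pᵢ Rᵢ Pₒ Rₒ ⟩
  (Pᵢ + Pₒ) + (Rᵢ + Rₒ) ∎
  where
  open ≡-Reasoning
  ∨ᵢ = count (λ s → P (inside ∷ s) ∨ R (inside ∷ s))
  ∨ₒ = count (λ s → P (outside ∷ s) ∨ R (outside ∷ s))
  ∧ᵢ = count (λ s → P (inside ∷ s) ∧ R (inside ∷ s))
  ∧ₒ = count (λ s → P (outside ∷ s) ∧ R (outside ∷ s))
  Pᵢ = count (P ∘ (inside ∷_))
  Pₒ = count (P ∘ (outside ∷_))
  Rᵢ = count (R ∘ (inside ∷_))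
  Rₒ = count (R ∘ (outside ∷_))

count-false : count {n} (λ _ → false) ≡ 0
count-false {zero}  = refl
count-false {suc n} = cong₂ _+_ (count-false {n}) (count-false {n})

count-∨-≤ : (P R : Subset n → Bool) → count (λ s → P s ∨ R s) ≤ count P + count R
count-∨-≤ P R = ≤-trans (m≤m+n _ _) (≤-reflexive (count-∨+count-∧ P R))

count-∨-disjoint : (P R : Subset n → Bool) → (∀ s → P s ≡ true → R s ≡ false) →
  count P + count R ≡ count (λ s → P s ∨ R s)
count-∨-disjoint {n} P R disjoint = begin
  count P + count R                                  ≡⟨ count-∨+count-∧ P R ⟨
  count (λ s → P s ∨ R s) + count (λ s → P s ∧ R s)
    ≡⟨ cong (count (λ s → P s ∨ R s) +_) (trans (count-cong P∧R≡false) (count-false {n})) ⟩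
  count (λ s → P s ∨ R s) + 0                        ≡⟨ +-identityʳ _ ⟩
  count (λ s → P s ∨ R s)                            ∎
  where
  open ≡-Reasoning
  P∧R≡false : ∀ s → P s ∧ R s ≡ false
  P∧R≡false s with P s in eq
  ... | true  = disjoint s eq
  ... | false = refl

_≟ₛ_ : (s x : Subset n) → Dec (s ≡ x)
_≟ₛ_ = ≡-dec _≟ᵇ_

count-singleton : (x : Subset n) → count (λ s → does (s ≟ₛ x)) ≡ 1
count-singleton []            = refl
count-singleton {suc n} (inside ∷ x)  = cong₂ _+_ (count-singleton x) (count-false {n})
count-singleton {suc n} (outside ∷ x) = cong₂ _+_ (count-false {n}) (count-singleton x)

count-insert : {R Q : Subset n → Bool} (x : Subset n) → R x ≡ false → Q x ≡ true →
  (∀ s → R s ≡ true → Q s ≡ true) → suc (count R) ≤ count Q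
count-insert {R = R} {Q} x Rx≡false Qx R⇒Q = begin
  suc (count R)                              ≡⟨ +-comm 1 (count R) ⟩
  count R + 1                                ≡⟨ cong (count R +_) (count-singleton x) ⟨
  count R + count (λ s → does (s ≟ₛ x))      ≡⟨ count-∨-disjoint R _ x∉R ⟩
  count (λ s → R s ∨ does (s ≟ₛ x))          ≤⟨ count-mono R∨x⇒Q ⟩
  count Q                                    ∎
  where
  open ≤-Reasoning
  x∉R : ∀ s → R s ≡ true → does (s ≟ₛ x) ≡ false
  x∉R s Rs with s ≟ₛ x
  ... | yes refl with () ← trans (sym Rx≡false) Rs
  ... | no _     = refl
  R∨x⇒Q : ∀ s → R s ∨ does (s ≟ₛ x) ≡ true → Q s ≡ true
  R∨x⇒Q s h with R s in eq | s ≟ₛ x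
  ... | true  | _        = R⇒Q s eq
  ... | false | yes refl = Qx

count-∧-< : {Q P : Subset n → Bool} (x : Subset n) → Q x ≡ true → P x ≡ false →
  count (λ s → Q s ∧ P s) < count Q
count-∧-< {Q = Q} {P} x Qx Px =
  count-insert x (trans (cong (Q x ∧_) Px) (∧-zeroʳ (Q x))) Qx (λ s → ∧-conicalˡ (Q s) (P s))

count-≤-image : ∀ {m} (g : Fin m → Subset n) {P : Subset n → Bool} →
  (∀ s → P s ≡ true → ∃ λ i → s ≡ g i) → count P ≤ m
count-≤-image {n} {zero} g {P} P⊆img = begin
  count P                ≤⟨ count-mono (λ s Ps → case proj₁ (P⊆img s Ps) of λ ()) ⟩
  count {n} (λ _ → false) ≡⟨ count-false {n} ⟩
  0                      ∎
  where open ≤-Reasoning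
count-≤-image {n} {suc m} g {P} P⊆img = begin
  count P                                ≤⟨ count-mono P⇒g₀∨P′ ⟩
  count (λ s → does (s ≟ₛ g zero) ∨ P′ s) ≤⟨ count-∨-≤ _ P′ ⟩
  count (λ s → does (s ≟ₛ g zero)) + count P′
    ≤⟨ +-mono-≤ (≤-reflexive (count-singleton (g zero))) (count-≤-image (g ∘ suc) P′⊆img) ⟩
  suc m                                  ∎
  where
  open ≤-Reasoning
  P′ : Subset n → Bool
  P′ s = P s ∧ not (does (s ≟ₛ g zero))
  P⇒g₀∨P′ : ∀ s → P s ≡ true → does (s ≟ₛ g zero) ∨ P′ s ≡ true
  P⇒g₀∨P′ s Ps with s ≟ₛ g zero
  ... | yes _ = refl
  ... | no _  rewrite Ps = refl
  P′⊆img : ∀ s → P′ s ≡ true → ∃ λ i → s ≡ g (suc i)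
  P′⊆img s P′s with P⊆img s (∧-conicalˡ _ _ P′s)
  ... | suc i , s≡ = i , s≡
  ... | zero , refl
    with () ← trans (sym (cong not (dec-true (g zero ≟ₛ g zero) refl))) (∧-conicalʳ (P (g zero)) _ P′s)

count-≥-injection : ∀ {m} (g : Fin m → Subset n) → Injective _≡_ _≡_ g →
  {P : Subset n → Bool} → (∀ i → P (g i) ≡ true) → m ≤ count P
count-≥-injection {m = zero}  g g-inj P∘g = z≤n
count-≥-injection {m = suc m} g g-inj {P} P∘g =
  ≤-trans (s≤s (count-≥-injection (g ∘ suc) (Finₚ.suc-injective ∘ g-inj) P′∘g∘suc))
          (count-insert {R = P′} (g zero) P′g₀≡false (P∘g zero) (λ s → ∧-conicalˡ (P s) _))
  where
  P′ : Subset _ → Bool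
  P′ s = P s ∧ not (does (s ≟ₛ g zero))
  P′g₀≡false : P′ (g zero) ≡ false
  P′g₀≡false = trans (cong (λ b → P (g zero) ∧ not b) (dec-true (g zero ≟ₛ g zero) refl))
                     (∧-zeroʳ (P (g zero)))
  P′∘g∘suc : ∀ i → P′ (g (suc i)) ≡ true
  P′∘g∘suc i = cong₂ (λ a b → a ∧ not b) (P∘g (suc i))
                      (dec-false (g (suc i) ≟ₛ g zero) (Finₚ.0≢1+n ∘ sym ∘ g-inj))

subsetOfSizeᵇ : Subset n → ℕ → Subset n → Bool
subsetOfSizeᵇ Y q s = does (s ⊆? Y) ∧ does (∣ s ∣ ≟ q)

subsetOfSizeᵇ⁺ : {Y s : Subset n} {q : ℕ} → s ⊆ Y → ∣ s ∣ ≡ q → subsetOfSizeᵇ Y q s ≡ true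
subsetOfSizeᵇ⁺ {Y = Y} {s} {q} s⊆Y ∣s∣≡q = cong₂ _∧_ (dec-true (s ⊆? Y) s⊆Y) (dec-true (∣ s ∣ ≟ q) ∣s∣≡q)

subsetOfSizeᵇ⁻ : {Y s : Subset n} {q : ℕ} → subsetOfSizeᵇ Y q s ≡ true → s ⊆ Y × ∣ s ∣ ≡ q
subsetOfSizeᵇ⁻ {Y = Y} {s} {q} h =
  dec-true⁻¹ (s ⊆? Y) (∧-conicalˡ _ _ h) , dec-true⁻¹ (∣ s ∣ ≟ q) (∧-conicalʳ _ _ h)

count-subsetOfSize : (Y : Subset n) (q : ℕ) → count (subsetOfSizeᵇ Y q) ≡ ∣ Y ∣ C q
count-subsetOfSize []            zero    = refl
count-subsetOfSize []            (suc q) = refl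
count-subsetOfSize {suc n} (inside ∷ Y) zero =
  cong₂ _+_ (trans (count-cong (λ s → ∧-zeroʳ (does (s ⊆? Y)))) (count-false {n}))
            (count-subsetOfSize Y zero)
count-subsetOfSize (inside ∷ Y)  (suc q) =
  trans (cong₂ _+_ (count-subsetOfSize Y q) (count-subsetOfSize Y (suc q)))
        (nCk+nC[k+1]≡[n+1]C[k+1] ∣ Y ∣ q)
count-subsetOfSize {suc n} (outside ∷ Y) q =
  cong₂ _+_ (count-false {n}) (count-subsetOfSize Y q)

C-suc-≤ : ∀ n k → n C k ≤ suc n C k
C-suc-≤ n zero    = ≤-refl
C-suc-≤ n (suc k) = ≤-trans (m≤n+m (n C suc k) (n C k)) (≤-reflexive (nCk+nC[k+1]≡[n+1]C[k+1] n k))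

C-monoˡ : ∀ {m n} k → m ≤ n → m C k ≤ n C k
C-monoˡ k m≤n = go (≤⇒≤′ m≤n)
  where
  go : ∀ {m n} → m ≤′ n → m C k ≤ n C k
  go ≤′-refl     = ≤-refl
  go (≤′-step h) = ≤-trans (go h) (C-suc-≤ _ k)

C-pos : ∀ {n k} → k ≤ n → 0 < n C k
C-pos {n}     {zero}  _         = ≤-refl
C-pos {suc n} {suc k} (s≤s k≤n) =
  ≤-trans (C-pos k≤n) (≤-trans (m≤m+n (n C k) (n C suc k)) (≤-reflexive (nCk+nC[k+1]≡[n+1]C[k+1] n k)))

C-<-monoˡ : ∀ {m n} k → suc k ≤ m → m < n → m C suc k < n C suc k
C-<-monoˡ {m} {n} k k<m m<n = begin-strict
  m C suc k                 <⟨ m<n+m (m C suc k) (C-pos (<⇒≤ k<m)) ⟩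
  m C k + m C suc k         ≡⟨ nCk+nC[k+1]≡[n+1]C[k+1] m k ⟩
  suc m C suc k             ≤⟨ C-monoˡ (suc k) m<n ⟩
  n C suc k                 ∎
  where open ≤-Reasoning

C-pred-< : ∀ {t r m} → 2 ≤ r → r ≤ t → t < m → (t ∸ 1) C (r ∸ 1) < (m ∸ 1) C (r ∸ 1)
C-pred-< {suc t} {suc (suc r)} {suc m} _ (s≤s r<t) (s≤s t<m) = C-<-monoˡ r r<t t<m
C-pred-< {suc t} {suc zero}    {suc m} (s≤s ()) _ _

C-cut-bound′ : ∀ R {s} → 1 ≤ s → ∀ u →
  s C suc (suc R) + suc u C suc (suc R) + (s + u) C suc R ≤ (s + suc u) C suc (suc R)
C-cut-bound′ R {s} _ zero = ≤-reflexive (begin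
  s C 2+R + 1 C 2+R + (s + 0) C suc R
    ≡⟨ cong₂ (λ a b → s C 2+R + a + b C suc R) (k>n⇒nCk≡0 {1} {2+R} (s≤s (s≤s z≤n))) (+-identityʳ s) ⟩
  s C 2+R + 0 + s C suc R             ≡⟨ cong (_+ s C suc R) (+-identityʳ (s C 2+R)) ⟩
  s C 2+R + s C suc R                 ≡⟨ +-comm (s C 2+R) (s C suc R) ⟩
  s C suc R + s C 2+R                 ≡⟨ nCk+nC[k+1]≡[n+1]C[k+1] s (suc R) ⟩
  suc s C 2+R                         ≡⟨ cong (_C 2+R) (+-comm 1 s) ⟩
  (s + 1) C 2+R                       ∎)
  where
  open ≡-Reasoning
  2+R = suc (suc R)
C-cut-bound′ R {s} 1≤s (suc u) = begin
  s C 2+R + suc (suc u) C 2+R + (s + suc u) C suc R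
    ≡⟨ cong (λ z → s C 2+R + z + (s + suc u) C suc R) (nCk+nC[k+1]≡[n+1]C[k+1] (suc u) (suc R)) ⟨
  s C 2+R + (suc u C suc R + suc u C 2+R) + (s + suc u) C suc R
    ≤⟨ +-monoˡ-≤ _ (+-monoʳ-≤ (s C 2+R) (+-monoˡ-≤ _ (C-monoˡ (suc R) (+-monoˡ-≤ u 1≤s)))) ⟩
  s C 2+R + ((s + u) C suc R + suc u C 2+R) + (s + suc u) C suc R
    ≡⟨ solve 4 (λ x y z w → x :+ (z :+ y) :+ w := w :+ (x :+ y :+ z)) refl
         (s C 2+R) (suc u C 2+R) ((s + u) C suc R) ((s + suc u) C suc R) ⟩
  (s + suc u) C suc R + (s C 2+R + suc u C 2+R + (s + u) C suc R)
    ≤⟨ +-monoʳ-≤ _ (C-cut-bound′ R 1≤s u) ⟩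
  (s + suc u) C suc R + (s + suc u) C 2+R
    ≡⟨ nCk+nC[k+1]≡[n+1]C[k+1] (s + suc u) (suc R) ⟩
  suc (s + suc u) C 2+R
    ≡⟨ cong (_C 2+R) (+-suc s (suc u)) ⟨
  (s + suc (suc u)) C 2+R ∎
  where
  open ≤-Reasoning
  open +-*-Solver
  2+R = suc (suc R)

C-cut-bound : ∀ {r} → 2 ≤ r → ∀ {s₁ s₂} → 1 ≤ s₁ → 1 ≤ s₂ →
  s₁ C r + s₂ C r + (s₁ + s₂ ∸ 1) C (r ∸ 1) ≤ (s₁ + s₂) C r
C-cut-bound {suc (suc R)} _           {s₁} {suc u} 1≤s₁ _ =
  subst (λ m → s₁ C suc (suc R) + suc u C suc (suc R) + m C suc R ≤ (s₁ + suc u) C suc (suc R))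
        (cong (_∸ 1) (sym (+-suc s₁ u))) (C-cut-bound′ R 1≤s₁ u)
C-cut-bound {suc zero}    (s≤s ())

2≤n⇒⌈n/2⌉<n : ∀ {n} → 2 ≤ n → ⌈ n /2⌉ < n
2≤n⇒⌈n/2⌉<n {suc (suc n)} _ = ⌈n/2⌉<n n
2≤n⇒⌈n/2⌉<n {suc zero} (s≤s ())

crossingᵇ : Subset n → Edges n → Subset n → Subset n → Bool
crossingᵇ V′ E′ X s = E′ s ∧ (meetsᵇ s X ∧ meetsᵇ s (V′ ─ X))

d≡count-crossing : (V′ : Subset n) (E′ : Edges n) (X : Subset n) → d V′ E′ X ≡ count (crossingᵇ V′ E′ X)
d≡count-crossing V′ E′ X = length-filterᵇ-allSubsets _ (crossingᵇ V′ E′ X)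

crossingᵇ⁺ : (V′ : Subset n) (E′ : Edges n) (X : Subset n) {s : Subset n} {x y : Fin n} →
  s ∈E E′ → x ∈ s → x ∈ X → y ∈ s → y ∈ V′ ─ X → crossingᵇ V′ E′ X s ≡ true
crossingᵇ⁺ V′ E′ X {s} s∈E′ x∈s x∈X y∈s y∈V′─X =
  cong₂ _∧_ s∈E′ (cong₂ _∧_ (meetsᵇ⁺ s X x∈s x∈X) (meetsᵇ⁺ s (V′ ─ X) y∈s y∈V′─X))

d-≤-image : ∀ {m} {E : Edges n} {V′ : Subset n} {E′ : Edges n} {X : Subset n} →
  IsSub E V′ E′ → (g : Fin m → Subset n) →
  (∀ s {x y} → s ∈E E → s ⊆ V′ → x ∈ s → x ∈ X → y ∈ s → y ∈ V′ ─ X → ∃ λ i → s ≡ g i) →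
  d V′ E′ X ≤ m
d-≤-image {V′ = V′} {E′} {X} sub g crossing⇒img =
  subst (_≤ _) (sym (d≡count-crossing V′ E′ X)) (count-≤-image g crossing⇒g)
  where
  crossing⇒g : ∀ s → crossingᵇ V′ E′ X s ≡ true → ∃ λ i → s ≡ g i
  crossing⇒g s h with sub s (∧-conicalˡ _ _ h) | ∧-conicalʳ (E′ s) _ h
  ... | s∈E , s⊆V′ | meets =
    let x , x∈s , x∈X = meetsᵇ⁻ s X (∧-conicalˡ _ _ meets)
        y , y∈s , y∈V′─X = meetsᵇ⁻ s (V′ ─ X) (∧-conicalʳ (meetsᵇ s X) _ meets)
    in crossing⇒img s s∈E s⊆V′ x∈s x∈X y∈s y∈V′─X

count-subsetOfSize-≤-cut : ∀ {r} (Z X : Subset n) (Q : Subset n → Bool) →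
  (∀ s → ∣ s ∣ ≡ r → s ⊆ Z → Nonempty (s ∩ X) → Nonempty (s ─ X) → Q s ≡ true) →
  ∣ Z ∣ C r ≤ ∣ Z ∩ X ∣ C r + ∣ Z ─ X ∣ C r + count (λ s → Q s ∧ does (s ⊆? Z))
count-subsetOfSize-≤-cut {n} {r} Z X Q crossing⇒Q = begin
  ∣ Z ∣ C r
    ≡⟨ count-subsetOfSize Z r ⟨
  count (subsetOfSizeᵇ Z r)
    ≤⟨ count-mono classify ⟩
  count (λ s → subsetOfSizeᵇ (Z ∩ X) r s ∨ (subsetOfSizeᵇ (Z ─ X) r s ∨ Q′ s))
    ≤⟨ count-∨-≤ (subsetOfSizeᵇ (Z ∩ X) r) _ ⟩
  count (subsetOfSizeᵇ (Z ∩ X) r) + count (λ s → subsetOfSizeᵇ (Z ─ X) r s ∨ Q′ s)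
    ≤⟨ +-monoʳ-≤ _ (count-∨-≤ (subsetOfSizeᵇ (Z ─ X) r) Q′) ⟩
  count (subsetOfSizeᵇ (Z ∩ X) r) + (count (subsetOfSizeᵇ (Z ─ X) r) + count Q′)
    ≡⟨ cong₂ (λ a b → a + (b + count Q′)) (count-subsetOfSize (Z ∩ X) r) (count-subsetOfSize (Z ─ X) r) ⟩
  ∣ Z ∩ X ∣ C r + (∣ Z ─ X ∣ C r + count Q′)
    ≡⟨ +-assoc (∣ Z ∩ X ∣ C r) (∣ Z ─ X ∣ C r) (count Q′) ⟨
  ∣ Z ∩ X ∣ C r + ∣ Z ─ X ∣ C r + count Q′ ∎
  where
  open ≤-Reasoning
  Q′ : Subset n → Bool
  Q′ s = Q s ∧ does (s ⊆? Z)
  classify : ∀ s → subsetOfSizeᵇ Z r s ≡ true →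
    subsetOfSizeᵇ (Z ∩ X) r s ∨ (subsetOfSizeᵇ (Z ─ X) r s ∨ Q′ s) ≡ true
  classify s s∈Zᵣ with subsetOfSizeᵇ⁻ s∈Zᵣ
  ... | s⊆Z , ∣s∣≡r with nonempty? (s ∩ X) | nonempty? (s ─ X)
  ... | no s∩X≡∅ | _ =
    trans (cong (λ b → subsetOfSizeᵇ (Z ∩ X) r s ∨ (b ∨ Q′ s)) (subsetOfSizeᵇ⁺ (Empty-∩⇒⊆─ s⊆Z s∩X≡∅) ∣s∣≡r))
          (∨-zeroʳ _)
  ... | yes _ | no s─X≡∅ =
    cong (_∨ (subsetOfSizeᵇ (Z ─ X) r s ∨ Q′ s)) (subsetOfSizeᵇ⁺ (Empty-─⇒⊆∩ s⊆Z s─X≡∅) ∣s∣≡r)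
  ... | yes s∩X≢∅ | yes s─X≢∅ =
    trans (cong₂ (λ a b → subsetOfSizeᵇ (Z ∩ X) r s ∨ (subsetOfSizeᵇ (Z ─ X) r s ∨ (a ∧ b)))
                 (crossing⇒Q s ∣s∣≡r s⊆Z s∩X≢∅ s─X≢∅) (dec-true (s ⊆? Z) s⊆Z))
          (trans (cong (subsetOfSizeᵇ (Z ∩ X) r s ∨_) (∨-zeroʳ _)) (∨-zeroʳ _))

complete-cut : ∀ {r} → 2 ≤ r → (Z X : Subset n) (Q : Subset n → Bool) →
  (∀ s → ∣ s ∣ ≡ r → s ⊆ Z → Nonempty (s ∩ X) → Nonempty (s ─ X) → Q s ≡ true) →
  Nonempty (Z ∩ X) → Nonempty (Z ─ X) →
  (∣ Z ∣ ∸ 1) C (r ∸ 1) ≤ count (λ s → Q s ∧ does (s ⊆? Z))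
complete-cut {r = r} 2≤r Z X Q crossing⇒Q Z∩X≢∅ Z─X≢∅ =
  +-cancelˡ-≤ (∣ Z ∩ X ∣ C r + ∣ Z ─ X ∣ C r) _ _ (begin
    ∣ Z ∩ X ∣ C r + ∣ Z ─ X ∣ C r + (∣ Z ∣ ∸ 1) C (r ∸ 1)
      ≡⟨ cong (λ m → ∣ Z ∩ X ∣ C r + ∣ Z ─ X ∣ C r + (m ∸ 1) C (r ∸ 1)) (∣p∩q∣+∣p─q∣≡∣p∣ Z X) ⟨
    ∣ Z ∩ X ∣ C r + ∣ Z ─ X ∣ C r + (∣ Z ∩ X ∣ + ∣ Z ─ X ∣ ∸ 1) C (r ∸ 1)
      ≤⟨ C-cut-bound 2≤r (Nonempty⇒1≤∣p∣ Z∩X≢∅) (Nonempty⇒1≤∣p∣ Z─X≢∅) ⟩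
    (∣ Z ∩ X ∣ + ∣ Z ─ X ∣) C r
      ≡⟨ cong (_C r) (∣p∩q∣+∣p─q∣≡∣p∣ Z X) ⟩
    ∣ Z ∣ C r
      ≤⟨ count-subsetOfSize-≤-cut Z X Q crossing⇒Q ⟩
    ∣ Z ∩ X ∣ C r + ∣ Z ─ X ∣ C r + count (λ s → Q s ∧ does (s ⊆? Z)) ∎)
  where open ≤-Reasoning

module Construction
  {k t r n l p : ℕ} (r<t : r < t) (2<r : 2 < r) (k≡ : k ≡ (t ∸ 1) C (r ∸ 1)) (2t+2≤l : 2 * t + 2 ≤ l)
  {A B : Subset n} {S : Fin p → Subset n}
  (∣A∣≡ : ∣ A ∣ ≡ ⌈ l /2⌉) (∣B∣≡ : ∣ B ∣ ≡ ⌊ l /2⌋) (∣S∣≡t : ∀ j → ∣ S j ∣ ≡ t)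
  (A-B-disjoint : ∀ v → v ∈ A → v ∉ B)
  (S-outside-AB : ∀ j v → v ∈ S j → v ∉ A × v ∉ B)
  (S-disjoint : ∀ i j v → i ≢ j → v ∈ S i → v ∉ S j)
  (covered : ∀ v → v ∈ A ⊎ v ∈ B ⊎ ∃ λ j → v ∈ S j)
  {F₀ : Fin k → Subset n} (F₀-injective : Injective _≡_ _≡_ F₀)
  (F₀-shape : ∀ i → ∣ F₀ i ∣ ≡ r × F₀ i ⊆ A ∪ B × Nonempty (F₀ i ∩ A) × Nonempty (F₀ i ∩ B))
  {F : Fin p → Fin k → Subset n} (F-injective : ∀ j → Injective _≡_ _≡_ (F j))
  (F-shape : ∀ j i → ∣ F j i ∣ ≡ r × F j i ⊆ S j ∪ (A ∪ B)
                     × Nonempty (F j i ∩ S j) × Nonempty (F j i ∩ (A ∪ B)))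
  (F-covers : ∀ j v → v ∈ S j → ∃ λ i → v ∈ F j i)
  (F-meets-A-B : ∀ j → (∃ λ i → Nonempty (F j i ∩ A)) × (∃ λ i → Nonempty (F j i ∩ B)))
  {E : Edges n}
  (E-def : ∀ e → e ∈E E ⇔
       ((∣ e ∣ ≡ r × e ⊆ A) ⊎ (∣ e ∣ ≡ r × e ⊆ B) ⊎ (∃ λ j → ∣ e ∣ ≡ r × e ⊆ S j)
        ⊎ (∃ λ i → e ≡ F₀ i) ⊎ (∃₂ λ j i → e ≡ F j i)))
  where

  open Equivalence

  H₀ : Subset n
  H₀ = A ∪ B

  H₀⁻ : ∀ {v} → v ∈ H₀ → v ∈ A ⊎ v ∈ B
  H₀⁻ = x∈p∪q⁻ A B

  A⊆H₀ : A ⊆ H₀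
  A⊆H₀ = x∈p∪q⁺ ∘ inj₁

  B⊆H₀ : B ⊆ H₀
  B⊆H₀ = x∈p∪q⁺ ∘ inj₂

  S∉H₀ : ∀ j {v} → v ∈ S j → v ∉ H₀
  S∉H₀ j v∈Sⱼ v∈H₀ with H₀⁻ v∈H₀
  ... | inj₁ v∈A = proj₁ (S-outside-AB j _ v∈Sⱼ) v∈A
  ... | inj₂ v∈B = proj₂ (S-outside-AB j _ v∈Sⱼ) v∈B

  S-unique : ∀ i j {v} → v ∈ S i → v ∈ S j → i ≡ j
  S-unique i j v∈Sᵢ v∈Sⱼ with i ≟ᶠ j
  ... | yes i≡j = i≡j
  ... | no  i≢j = ⊥-elim (S-disjoint i j _ i≢j v∈Sᵢ v∈Sⱼ)

  F⊆S∪H₀ : ∀ j i {v} → v ∈ F j i → v ∈ S j ⊎ v ∈ H₀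
  F⊆S∪H₀ j i = x∈p∪q⁻ (S j) H₀ ∘ proj₁ (proj₂ (F-shape j i))

  H₀∖A⊆B : ∀ {v} → v ∈ H₀ → v ∉ A → v ∈ B
  H₀∖A⊆B v∈H₀ v∉A with H₀⁻ v∈H₀
  ... | inj₁ v∈A = ⊥-elim (v∉A v∈A)
  ... | inj₂ v∈B = v∈B

  H₀∖B⊆A : ∀ {v} → v ∈ H₀ → v ∉ B → v ∈ A
  H₀∖B⊆A v∈H₀ v∉B with H₀⁻ v∈H₀
  ... | inj₁ v∈A = v∈A
  ... | inj₂ v∈B = ⊥-elim (v∉B v∈B)

  Complete : Subset n → Set
  Complete Z = ∀ s → ∣ s ∣ ≡ r → s ⊆ Z → s ∈E E

  A-complete : Complete A
  A-complete s ∣s∣≡r s⊆A = from (E-def s) (inj₁ (∣s∣≡r , s⊆A))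

  B-complete : Complete B
  B-complete s ∣s∣≡r s⊆B = from (E-def s) (inj₂ (inj₁ (∣s∣≡r , s⊆B)))

  S-complete : ∀ j → Complete (S j)
  S-complete j s ∣s∣≡r s⊆Sⱼ = from (E-def s) (inj₂ (inj₂ (inj₁ (j , ∣s∣≡r , s⊆Sⱼ))))

  F₀∈E : ∀ i → F₀ i ∈E E
  F₀∈E i = from (E-def (F₀ i)) (inj₂ (inj₂ (inj₂ (inj₁ (i , refl)))))

  F∈E : ∀ j i → F j i ∈E E
  F∈E j i = from (E-def (F j i)) (inj₂ (inj₂ (inj₂ (inj₂ (j , i , refl)))))

  t<∣B∣ : t < ∣ B ∣
  t<∣B∣ = begin
    suc t                 ≡⟨ n≡⌊n+n/2⌋ (suc t) ⟩
    ⌊ suc t + suc t /2⌋   ≡⟨ cong ⌊_/2⌋ (solve 1 (λ x → (con 1 :+ x) :+ (con 1 :+ x) := con 2 :* x :+ con 2) refl t) ⟩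
    ⌊ 2 * t + 2 /2⌋       ≤⟨ ⌊n/2⌋-mono 2t+2≤l ⟩
    ⌊ l /2⌋               ≡⟨ ∣B∣≡ ⟨
    ∣ B ∣                 ∎
    where
    open ≤-Reasoning
    open +-*-Solver

  ∣B∣≤∣A∣ : ∣ B ∣ ≤ ∣ A ∣
  ∣B∣≤∣A∣ = subst₂ _≤_ (sym ∣B∣≡) (sym ∣A∣≡) (⌊n/2⌋≤⌈n/2⌉ l)

  t<∣A∣ : t < ∣ A ∣
  t<∣A∣ = <-≤-trans t<∣B∣ ∣B∣≤∣A∣

  ∣A∣<l : ∣ A ∣ < l
  ∣A∣<l = subst (_< l) (sym ∣A∣≡) (2≤n⇒⌈n/2⌉<n (≤-trans (m≤n+m 2 (2 * t)) 2t+2≤l))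

  ∣H₀∣≡l : ∣ H₀ ∣ ≡ l
  ∣H₀∣≡l = begin
    ∣ A ∪ B ∣             ≡⟨ ∣p∪q∣≡∣p∣+∣q∣ A B A-B-disjoint ⟩
    ∣ A ∣ + ∣ B ∣         ≡⟨ cong₂ _+_ ∣A∣≡ ∣B∣≡ ⟩
    ⌈ l /2⌉ + ⌊ l /2⌋     ≡⟨ +-comm ⌈ l /2⌉ ⌊ l /2⌋ ⟩
    ⌊ l /2⌋ + ⌈ l /2⌉     ≡⟨ ⌊n/2⌋+⌈n/2⌉≡n l ⟩
    l                     ∎
    where open ≡-Reasoning

  0<k : 0 < k
  0<k = subst (0 <_) (sym k≡) (C-pos (∸-monoˡ-≤ 1 (<⇒≤ r<t)))

  i₀ : Fin k
  i₀ = fromℕ< 0<k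

  F₀⊆H₀ : ∀ i → F₀ i ⊆ H₀
  F₀⊆H₀ i = proj₁ (proj₂ (F₀-shape i))

  F₀-meets-A : ∀ i → ∃ λ a → a ∈ F₀ i × a ∈ A
  F₀-meets-A i = Nonempty-∩⁻ (F₀ i) A (proj₁ (proj₂ (proj₂ (F₀-shape i))))

  F₀-meets-B : ∀ i → ∃ λ b → b ∈ F₀ i × b ∈ B
  F₀-meets-B i = Nonempty-∩⁻ (F₀ i) B (proj₂ (proj₂ (proj₂ (F₀-shape i))))

  F-meets-S : ∀ j i → ∃ λ z → z ∈ F j i × z ∈ S j
  F-meets-S j i = Nonempty-∩⁻ (F j i) (S j) (proj₁ (proj₂ (proj₂ (F-shape j i))))

  F-meets-H₀ : ∀ j i → ∃ λ h → h ∈ F j i × h ∈ H₀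
  F-meets-H₀ j i = Nonempty-∩⁻ (F j i) H₀ (proj₂ (proj₂ (proj₂ (F-shape j i))))

  F⊈H₀ : ∀ j i → ¬ (F j i ⊆ H₀)
  F⊈H₀ j i F⊆H₀ = let z , z∈F , z∈Sⱼ = F-meets-S j i in S∉H₀ j z∈Sⱼ (F⊆H₀ z∈F)

  a₀ b₀ : Fin n
  a₀ = proj₁ (F₀-meets-A i₀)
  b₀ = proj₁ (F₀-meets-B i₀)

  a₀∈F₀i₀ : a₀ ∈ F₀ i₀
  a₀∈F₀i₀ = proj₁ (proj₂ (F₀-meets-A i₀))

  a₀∈A : a₀ ∈ A
  a₀∈A = proj₂ (proj₂ (F₀-meets-A i₀))

  b₀∈B : b₀ ∈ B
  b₀∈B = proj₂ (proj₂ (F₀-meets-B i₀))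

  t<l : t < l
  t<l = <-trans t<∣A∣ ∣A∣<l

  k<[m∸1]C[r∸1] : ∀ {m} → t < m → k < (m ∸ 1) C (r ∸ 1)
  k<[m∸1]C[r∸1] t<m = subst (_< _) (sym k≡) (C-pred-< (<⇒≤ 2<r) (<⇒≤ r<t) t<m)

  uniform : Uniform r E
  uniform s s∈E with to (E-def s) s∈E
  ... | inj₁ (∣s∣≡r , _)                         = ∣s∣≡r
  ... | inj₂ (inj₁ (∣s∣≡r , _))                  = ∣s∣≡r
  ... | inj₂ (inj₂ (inj₁ (_ , ∣s∣≡r , _)))       = ∣s∣≡r
  ... | inj₂ (inj₂ (inj₂ (inj₁ (i , refl))))     = proj₁ (F₀-shape i)
  ... | inj₂ (inj₂ (inj₂ (inj₂ (j , i , refl)))) = proj₁ (F-shape j i)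

  edge-leaving-S : ∀ j s {x y} → s ∈E E → x ∈ s → x ∈ S j → y ∈ s → y ∉ S j → ∃ λ i → s ≡ F j i
  edge-leaving-S j s s∈E x∈s x∈Sⱼ y∈s y∉Sⱼ with to (E-def s) s∈E
  ... | inj₁ (_ , s⊆A)        = ⊥-elim (proj₁ (S-outside-AB j _ x∈Sⱼ) (s⊆A x∈s))
  ... | inj₂ (inj₁ (_ , s⊆B)) = ⊥-elim (proj₂ (S-outside-AB j _ x∈Sⱼ) (s⊆B x∈s))
  ... | inj₂ (inj₂ (inj₁ (j′ , _ , s⊆Sⱼ′))) with refl ← S-unique j j′ x∈Sⱼ (s⊆Sⱼ′ x∈s) =
    ⊥-elim (y∉Sⱼ (s⊆Sⱼ′ y∈s))
  ... | inj₂ (inj₂ (inj₂ (inj₁ (i , refl)))) = ⊥-elim (S∉H₀ j x∈Sⱼ (F₀⊆H₀ i x∈s))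
  ... | inj₂ (inj₂ (inj₂ (inj₂ (j′ , i , refl)))) with F⊆S∪H₀ j′ i x∈s
  ...   | inj₂ x∈H₀  = ⊥-elim (S∉H₀ j x∈Sⱼ x∈H₀)
  ...   | inj₁ x∈Sⱼ′ with refl ← S-unique j j′ x∈Sⱼ x∈Sⱼ′ = i , refl

  edge-inside-H₀-leaving-A : ∀ s {x y} → s ∈E E → s ⊆ H₀ → x ∈ s → x ∈ A → y ∈ s → y ∉ A →
    ∃ λ i → s ≡ F₀ i
  edge-inside-H₀-leaving-A s s∈E s⊆H₀ x∈s x∈A y∈s y∉A with to (E-def s) s∈E
  ... | inj₁ (_ , s⊆A)                       = ⊥-elim (y∉A (s⊆A y∈s))
  ... | inj₂ (inj₁ (_ , s⊆B))                = ⊥-elim (A-B-disjoint _ x∈A (s⊆B x∈s))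
  ... | inj₂ (inj₂ (inj₁ (j , _ , s⊆Sⱼ)))    = ⊥-elim (proj₁ (S-outside-AB j _ (s⊆Sⱼ x∈s)) x∈A)
  ... | inj₂ (inj₂ (inj₂ (inj₁ (i , refl)))) = i , refl
  ... | inj₂ (inj₂ (inj₂ (inj₂ (j , i , refl)))) =
    ⊥-elim (F⊈H₀ j i s⊆H₀)

  subhypergraph-κ'≤k : ∀ V′ E′ → IsSub E V′ E′ → l ≤ ∣ V′ ∣ → κ'≤ V′ E′ k
  subhypergraph-κ'≤k V′ E′ sub l≤∣V′∣ with any? (λ j → nonempty? (V′ ∩ S j))
  ... | yes (j , V′∩Sⱼ≢∅) =
    V′ ∩ S j ,
    (p∩q⊆p V′ (S j) , V′∩Sⱼ≢∅ ,
     ∣q∣<∣p∣⇒Nonempty[p─p∩q] (subst (_< ∣ V′ ∣) (sym (∣S∣≡t j)) (<-≤-trans t<l l≤∣V′∣))) ,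
    d-≤-image sub (F j) λ s s∈E _ x∈s x∈V′∩Sⱼ y∈s y∈V′─V′∩Sⱼ →
      edge-leaving-S j s s∈E x∈s (proj₂ (x∈p∩q⁻ V′ (S j) x∈V′∩Sⱼ))
                         y∈s (proj₂ (x∈p─[p∩q]⁻ V′ (S j) y∈V′─V′∩Sⱼ))
  ... | no V′∩S≡∅ =
    V′ ∩ A , (p∩q⊆p V′ A , V′∩A≢∅ , ∣q∣<∣p∣⇒Nonempty[p─p∩q] (<-≤-trans ∣A∣<l l≤∣V′∣)) ,
    d-≤-image sub F₀ λ s s∈E s⊆V′ x∈s x∈V′∩A y∈s y∈V′─V′∩A →
      edge-inside-H₀-leaving-A s s∈E (V′⊆H₀ ∘ s⊆V′) x∈s (proj₂ (x∈p∩q⁻ V′ A x∈V′∩A))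
                                                    y∈s (proj₂ (x∈p─[p∩q]⁻ V′ A y∈V′─V′∩A))
    where
    V′⊆H₀ : V′ ⊆ H₀
    V′⊆H₀ {v} v∈V′ with covered v
    ... | inj₁ v∈A              = A⊆H₀ v∈A
    ... | inj₂ (inj₁ v∈B)       = B⊆H₀ v∈B
    ... | inj₂ (inj₂ (j , v∈Sⱼ)) = ⊥-elim (V′∩S≡∅ (j , v , x∈p∩q⁺ (v∈V′ , v∈Sⱼ)))
    V′∩A≢∅ : Nonempty (V′ ∩ A)
    V′∩A≢∅ with ∣q∣<∣p∣⇒Nonempty[p─p∩q] (<-≤-trans (≤-<-trans ∣B∣≤∣A∣ ∣A∣<l) l≤∣V′∣)
    ... | v , v∈V′─V′∩B with x∈p─[p∩q]⁻ V′ B v∈V′─V′∩B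
    ...   | v∈V′ , v∉B with H₀⁻ (V′⊆H₀ v∈V′)
    ...     | inj₁ v∈A = v , x∈p∩q⁺ (v∈V′ , v∈A)
    ...     | inj₂ v∈B = ⊥-elim (v∉B v∈B)

  module AddEdge (e : Subset n) (∣e∣≡r : ∣ e ∣ ≡ r) (e∉E : E e ≡ false) where

    Active : Fin p → Set
    Active j = Nonempty (e ∩ S j)

    InV″ : Fin n → Set
    InV″ v = v ∈ H₀ ⊎ ∃ λ j → v ∈ S j × Active j

    InV″? : ∀ v → Dec (InV″ v)
    InV″? v = v ∈? H₀ ⊎-dec any? λ j → v ∈? S j ×-dec nonempty? (e ∩ S j)

    V″ : Subset n
    V″ = subsetOf InV″?

    V″⁻ : ∀ {v} → v ∈ V″ → InV″ v
    V″⁻ = ∈-subsetOf⁻ InV″?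

    H₀⊆V″ : H₀ ⊆ V″
    H₀⊆V″ = ∈-subsetOf⁺ InV″? ∘ inj₁

    S⊆V″ : ∀ {j} → Active j → S j ⊆ V″
    S⊆V″ {j} act v∈Sⱼ = ∈-subsetOf⁺ InV″? (inj₂ (j , v∈Sⱼ , act))

    e⊆V″ : e ⊆ V″
    e⊆V″ {v} v∈e with covered v
    ... | inj₁ v∈A               = H₀⊆V″ (A⊆H₀ v∈A)
    ... | inj₂ (inj₁ v∈B)        = H₀⊆V″ (B⊆H₀ v∈B)
    ... | inj₂ (inj₂ (j , v∈Sⱼ)) = S⊆V″ (v , x∈p∩q⁺ (v∈e , v∈Sⱼ)) v∈Sⱼ

    F₀⊆V″ : ∀ i → F₀ i ⊆ V″
    F₀⊆V″ i = H₀⊆V″ ∘ F₀⊆H₀ i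

    F⊆V″ : ∀ {j} → Active j → ∀ i → F j i ⊆ V″
    F⊆V″ {j} act i v∈F with F⊆S∪H₀ j i v∈F
    ... | inj₁ v∈Sⱼ = S⊆V″ act v∈Sⱼ
    ... | inj₂ v∈H₀ = H₀⊆V″ v∈H₀

    E″ : Edges n
    E″ s = (E +E e) s ∧ does (s ⊆? V″)

    E″-sub : IsSub (E +E e) V″ E″
    E″-sub s s∈E″ = ∧-conicalˡ _ _ s∈E″ , dec-true⁻¹ (s ⊆? V″) (∧-conicalʳ ((E +E e) s) _ s∈E″)

    E″⁺ : ∀ {s} → s ∈E (E +E e) → s ⊆ V″ → s ∈E E″
    E″⁺ {s} s∈E+e s⊆V″ = cong₂ _∧_ s∈E+e (dec-true (s ⊆? V″) s⊆V″)

    E⊆E+e : ∀ {s} → s ∈E E → s ∈E (E +E e)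
    E⊆E+e s∈E = cong (_∨ _) s∈E

    e∈E+e : e ∈E (E +E e)
    e∈E+e = trans (cong (E e ∨_) (trans (isYes≗does (e ≟ₛ e)) (dec-true (e ≟ₛ e) refl))) (∨-zeroʳ (E e))

    l≤∣V″∣ : l ≤ ∣ V″ ∣
    l≤∣V″∣ = subst (_≤ ∣ V″ ∣) ∣H₀∣≡l (p⊆q⇒∣p∣≤∣q∣ H₀⊆V″)

    e-not-inside : ∀ {Z} → Complete Z → ∃ λ v → v ∈ e × v ∉ Z
    e-not-inside {Z} complete with ⊆-or-witness e Z
    ... | inj₂ witness = witness
    ... | inj₁ e⊆Z with () ← trans (sym e∉E) (complete e ∣e∣≡r e⊆Z)

    module Cut (X : Subset n) (X⊆V″ : X ⊆ V″) {x₀ y₀ : Fin n} (x₀∈X : x₀ ∈ X) (y₀∈V″─X : y₀ ∈ V″ ─ X) where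

      side : Fin n → Bool
      side v = does (v ∈? X)

      Q : Subset n → Bool
      Q = crossingᵇ V″ E″ X

      crosses : ∀ {s u v} → s ∈E (E +E e) → s ⊆ V″ → u ∈ s → v ∈ s → side u ≢ side v → Q s ≡ true
      crosses {u = u} {v} s∈E+e s⊆V″ u∈s v∈s u≁v with u ∈? X | v ∈? X
      ... | yes u∈X | no v∉X = crossingᵇ⁺ V″ E″ X (E″⁺ s∈E+e s⊆V″) u∈s u∈X v∈s (x∈p∧x∉q⇒x∈p─q (s⊆V″ v∈s) v∉X)
      ... | no u∉X | yes v∈X = crossingᵇ⁺ V″ E″ X (E″⁺ s∈E+e s⊆V″) v∈s v∈X u∈s (x∈p∧x∉q⇒x∈p─q (s⊆V″ u∈s) u∉X)
      ... | yes _ | yes _ = ⊥-elim (u≁v refl)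
      ... | no _  | no _  = ⊥-elim (u≁v refl)

      Split : Subset n → Set
      Split Z = Nonempty (Z ∩ X) × Nonempty (Z ─ X)

      split? : ∀ Z → Dec (Split Z)
      split? Z = nonempty? (Z ∩ X) ×-dec nonempty? (Z ─ X)

      Monochrome : Subset n → Set
      Monochrome Z = ∀ {u v} → u ∈ Z → v ∈ Z → side u ≡ side v

      ¬Split⇒Monochrome : ∀ {Z} → ¬ Split Z → Monochrome Z
      ¬Split⇒Monochrome ¬split {u} {v} u∈Z v∈Z with u ∈? X | v ∈? X
      ... | yes _   | yes _   = refl
      ... | no _    | no _    = refl
      ... | yes u∈X | no v∉X  = ⊥-elim (¬split ((u , x∈p∩q⁺ (u∈Z , u∈X)) , (v , x∈p∧x∉q⇒x∈p─q v∈Z v∉X)))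
      ... | no u∉X  | yes v∈X = ⊥-elim (¬split ((v , x∈p∩q⁺ (v∈Z , v∈X)) , (u , x∈p∧x∉q⇒x∈p─q u∈Z u∉X)))

      split-block-count : ∀ {Z} → Z ⊆ V″ → Complete Z → Split Z →
        (∣ Z ∣ ∸ 1) C (r ∸ 1) ≤ count (λ s → Q s ∧ does (s ⊆? Z))
      split-block-count {Z} Z⊆V″ complete (Z∩X≢∅ , Z─X≢∅) =
        complete-cut (<⇒≤ 2<r) Z X Q crossing Z∩X≢∅ Z─X≢∅
        where
        crossing : ∀ s → ∣ s ∣ ≡ r → s ⊆ Z → Nonempty (s ∩ X) → Nonempty (s ─ X) → Q s ≡ true
        crossing s ∣s∣≡r s⊆Z (x , x∈s∩X) (y , y∈s─X) =
          let x∈s , x∈X = x∈p∩q⁻ s X x∈s∩X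
              y∈s , y∉X = x∈p─q⁻ s X y∈s─X
          in crossingᵇ⁺ V″ E″ X (E″⁺ (E⊆E+e (complete s ∣s∣≡r s⊆Z)) (Z⊆V″ ∘ s⊆Z))
                        x∈s x∈X y∈s (x∈p∧x∉q⇒x∈p─q (Z⊆V″ (s⊆Z y∈s)) y∉X)

      large-split-block : ∀ {Z} → Z ⊆ V″ → Complete Z → t < ∣ Z ∣ → Split Z → suc k ≤ count Q
      large-split-block Z⊆V″ complete t<∣Z∣ Z-split =
        ≤-trans (k<[m∸1]C[r∸1] t<∣Z∣)
                (≤-trans (split-block-count Z⊆V″ complete Z-split) (count-mono (λ s → ∧-conicalˡ (Q s) _)))

      ∈-∉-≁ : ∀ {u v} → u ∈ X → v ∉ X → side u ≢ side v
      ∈-∉-≁ {u} {v} u∈X v∉X u∼v with () ← trans (sym (dec-true (u ∈? X) u∈X)) (trans u∼v (dec-false (v ∈? X) v∉X))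

      module MonochromeH₀ (A-mono : Monochrome A) (B-mono : Monochrome B) where

        H₀-side-a₀ : side a₀ ≡ side b₀ → ∀ {v} → v ∈ H₀ → side v ≡ side a₀
        H₀-side-a₀ a₀∼b₀ v∈H₀ with H₀⁻ v∈H₀
        ... | inj₁ v∈A = A-mono v∈A a₀∈A
        ... | inj₂ v∈B = trans (B-mono v∈B b₀∈B) (sym a₀∼b₀)

        F₀-crosses : side a₀ ≢ side b₀ → ∀ i → Q (F₀ i) ≡ true
        F₀-crosses a₀≁b₀ i =
          let a , a∈F₀ , a∈A = F₀-meets-A i
              b , b∈F₀ , b∈B = F₀-meets-B i
          in crosses (E⊆E+e (F₀∈E i)) (F₀⊆V″ i) a∈F₀ b∈F₀
                     (λ a∼b → a₀≁b₀ (trans (sym (A-mono a∈A a₀∈A)) (trans a∼b (B-mono b∈B b₀∈B))))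

        exit-S : ∀ j → Active j → ∀ {u w} → u ∈ S j → w ∈ S j → side u ≢ side w →
                 ∃ λ s → Q s ≡ true × ∃ λ v → v ∈ s × v ∉ S j
        exit-S j act {u} {w} u∈Sⱼ w∈Sⱼ u≁w with F-covers j u u∈Sⱼ | F-covers j w w∈Sⱼ
        ... | i₁ , u∈F₁ | i₂ , w∈F₂ with F-meets-H₀ j i₁ | F-meets-H₀ j i₂
        ... | h , h∈F₁ , h∈H₀ | h′ , h′∈F₂ , h′∈H₀ with side u ≟ᵇ side h | side w ≟ᵇ side h′
        ... | no u≁h | _ =
          F j i₁ , crosses (E⊆E+e (F∈E j i₁)) (F⊆V″ act i₁) u∈F₁ h∈F₁ u≁h , h , h∈F₁ , λ h∈Sⱼ → S∉H₀ j h∈Sⱼ h∈H₀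
        ... | yes _ | no w≁h′ =
          F j i₂ , crosses (E⊆E+e (F∈E j i₂)) (F⊆V″ act i₂) w∈F₂ h′∈F₂ w≁h′ , h′ , h′∈F₂ , λ h′∈Sⱼ → S∉H₀ j h′∈Sⱼ h′∈H₀
        ... | yes u∼h | yes w∼h′ =
          F₀ i₀ , F₀-crosses a₀≁b₀ i₀ , a₀ , a₀∈F₀i₀ , λ a₀∈Sⱼ → S∉H₀ j a₀∈Sⱼ (A⊆H₀ a₀∈A)
          where
          a₀≁b₀ : side a₀ ≢ side b₀
          a₀≁b₀ a₀∼b₀ = u≁w (trans u∼h (trans (H₀-side-a₀ a₀∼b₀ h∈H₀)
                                               (sym (trans w∼h′ (H₀-side-a₀ a₀∼b₀ h′∈H₀)))))

        S-split : ∀ j → Active j → Split (S j) → suc k ≤ count Q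
        S-split j act Sⱼ-split@((u , u∈Sⱼ∩X) , (w , w∈Sⱼ─X))
          with exit-S j act (proj₁ (x∈p∩q⁻ (S j) X u∈Sⱼ∩X)) (proj₁ (x∈p─q⁻ (S j) X w∈Sⱼ─X))
                            (∈-∉-≁ (proj₂ (x∈p∩q⁻ (S j) X u∈Sⱼ∩X)) (proj₂ (x∈p─q⁻ (S j) X w∈Sⱼ─X)))
        ... | s₀ , Qs₀ , v , v∈s₀ , v∉Sⱼ =
          ≤-<-trans k≤ (count-∧-< s₀ Qs₀ (dec-false (s₀ ⊆? S j) (λ s₀⊆Sⱼ → v∉Sⱼ (s₀⊆Sⱼ v∈s₀))))
          where
          k≤ : k ≤ count (λ s → Q s ∧ does (s ⊆? S j))
          k≤ = subst (_≤ count (λ s → Q s ∧ does (s ⊆? S j)))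
                     (trans (cong (λ m → (m ∸ 1) C (r ∸ 1)) (∣S∣≡t j)) (sym k≡))
                     (split-block-count (S⊆V″ act) (S-complete j) Sⱼ-split)

        e-crosses-inside-H₀ : side a₀ ≢ side b₀ → e ⊆ H₀ → Q e ≡ true
        e-crosses-inside-H₀ a₀≁b₀ e⊆H₀ with e-not-inside A-complete | e-not-inside B-complete
        ... | v , v∈e , v∉A | w , w∈e , w∉B =
          crosses e∈E+e e⊆V″ v∈e w∈e λ v∼w →
            a₀≁b₀ (trans (sym (A-mono (H₀∖B⊆A (e⊆H₀ w∈e) w∉B) a₀∈A))
                         (trans (sym v∼w) (B-mono (H₀∖A⊆B (e⊆H₀ v∈e) v∉A) b₀∈B)))

        some-F-crosses : side a₀ ≢ side b₀ → ∀ j → Active j → Monochrome (S j) → ∃ λ i → Q (F j i) ≡ true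
        some-F-crosses a₀≁b₀ j act Sⱼ-mono with F-meets-A-B j
        ... | (i₁ , F∩A≢∅) , (i₂ , F∩B≢∅) with Nonempty-∩⁻ (F j i₁) A F∩A≢∅ | Nonempty-∩⁻ (F j i₂) B F∩B≢∅
        ... | a , a∈F₁ , a∈A | b , b∈F₂ , b∈B with F-meets-S j i₁ | F-meets-S j i₂
        ... | z , z∈F₁ , z∈Sⱼ | z′ , z′∈F₂ , z′∈Sⱼ with side z ≟ᵇ side a
        ... | no z≁a  = i₁ , crosses (E⊆E+e (F∈E j i₁)) (F⊆V″ act i₁) z∈F₁ a∈F₁ z≁a
        ... | yes z∼a = i₂ , crosses (E⊆E+e (F∈E j i₂)) (F⊆V″ act i₂) z′∈F₂ b∈F₂ λ z′∼b →
          a₀≁b₀ (trans (sym (A-mono a∈A a₀∈A))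
                       (trans (sym z∼a) (trans (Sⱼ-mono z∈Sⱼ z′∈Sⱼ) (trans z′∼b (B-mono b∈B b₀∈B)))))

        A-B-split : (∀ j → Active j → Monochrome (S j)) → side a₀ ≢ side b₀ → suc k ≤ count Q
        A-B-split S-mono a₀≁b₀ = ≤-<-trans k≤ one-more
          where
          P : Subset n → Bool
          P s = E s ∧ does (s ⊆? H₀)
          k≤ : k ≤ count (λ s → Q s ∧ P s)
          k≤ = count-≥-injection F₀ F₀-injective λ i →
            cong₂ _∧_ (F₀-crosses a₀≁b₀ i) (cong₂ _∧_ (F₀∈E i) (dec-true (F₀ i ⊆? H₀) (F₀⊆H₀ i)))
          one-more : count (λ s → Q s ∧ P s) < count Q
          one-more with ⊆-or-witness e H₀
          ... | inj₁ e⊆H₀ = count-∧-< {P = P} e (e-crosses-inside-H₀ a₀≁b₀ e⊆H₀) (cong (_∧ does (e ⊆? H₀)) e∉E)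
          ... | inj₂ (v , v∈e , v∉H₀) with V″⁻ (e⊆V″ v∈e)
          ...   | inj₁ v∈H₀ = ⊥-elim (v∉H₀ v∈H₀)
          ...   | inj₂ (j , _ , act) with some-F-crosses a₀≁b₀ j act (S-mono j act)
          ...     | i , QFⱼᵢ = count-∧-< {P = P} (F j i) QFⱼᵢ
                          (trans (cong (E (F j i) ∧_) (dec-false (F j i ⊆? H₀) (F⊈H₀ j i))) (∧-zeroʳ _))

        opposite-S : side a₀ ≡ side b₀ → ∀ {v} → v ∈ V″ → side v ≢ side a₀ →
                     ∃ λ j → Active j × ∃ λ z → z ∈ S j × side z ≢ side a₀
        opposite-S a₀∼b₀ v∈V″ v≁a₀ with V″⁻ v∈V″
        ... | inj₁ v∈H₀              = ⊥-elim (v≁a₀ (H₀-side-a₀ a₀∼b₀ v∈H₀))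
        ... | inj₂ (j , v∈Sⱼ , act) = j , act , _ , v∈Sⱼ , v≁a₀

        some-opposite-S : side a₀ ≡ side b₀ → ∃ λ j → Active j × ∃ λ z → z ∈ S j × side z ≢ side a₀
        some-opposite-S a₀∼b₀ with side x₀ ≟ᵇ side a₀
        ... | no x₀≁a₀  = opposite-S a₀∼b₀ (X⊆V″ x₀∈X) x₀≁a₀
        ... | yes x₀∼a₀ = opposite-S a₀∼b₀ y₀∈V″ λ y₀∼a₀ → ∈-∉-≁ x₀∈X y₀∉X (trans x₀∼a₀ (sym y₀∼a₀))
          where
          y₀∈V″ = proj₁ (x∈p─q⁻ V″ X y₀∈V″─X)
          y₀∉X = proj₂ (x∈p─q⁻ V″ X y₀∈V″─X)

        F-crosses-from-opposite : side a₀ ≡ side b₀ → ∀ {j} → Active j →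
          (∀ {z} → z ∈ S j → side z ≢ side a₀) → ∀ i → Q (F j i) ≡ true
        F-crosses-from-opposite a₀∼b₀ {j} act Sⱼ-opposite i =
          let z , z∈F , z∈Sⱼ = F-meets-S j i
              h , h∈F , h∈H₀ = F-meets-H₀ j i
          in crosses (E⊆E+e (F∈E j i)) (F⊆V″ act i) z∈F h∈F λ z∼h →
               Sⱼ-opposite z∈Sⱼ (trans z∼h (H₀-side-a₀ a₀∼b₀ h∈H₀))

        H₀-mono : (∀ j → Active j → Monochrome (S j)) → side a₀ ≡ side b₀ → suc k ≤ count Q
        H₀-mono S-mono a₀∼b₀ with some-opposite-S a₀∼b₀
        ... | j , act , z , z∈Sⱼ , z≁a₀ = ≤-<-trans k≤ one-more
          where
          Sⱼ-opposite : ∀ {v} → v ∈ S j → side v ≢ side a₀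
          Sⱼ-opposite v∈Sⱼ = z≁a₀ ∘ trans (S-mono j act z∈Sⱼ v∈Sⱼ)
          P : Subset n → Bool
          P s = E s ∧ does (nonempty? (s ∩ S j))
          k≤ : k ≤ count (λ s → Q s ∧ P s)
          k≤ = count-≥-injection (F j) (F-injective j) λ i →
            cong₂ _∧_ (F-crosses-from-opposite a₀∼b₀ act Sⱼ-opposite i)
                      (cong₂ _∧_ (F∈E j i) (dec-true (nonempty? (F j i ∩ S j)) (proj₁ (proj₂ (proj₂ (F-shape j i))))))
          one-more : count (λ s → Q s ∧ P s) < count Q
          one-more with e-not-inside (S-complete j) | Nonempty-∩⁻ e (S j) act
          ... | w , w∈e , w∉Sⱼ | v , v∈e , v∈Sⱼ with side w ≟ᵇ side v
          ... | no w≁v = count-∧-< {P = P} e (crosses e∈E+e e⊆V″ w∈e v∈e w≁v) (cong (_∧ _) e∉E)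
          ... | yes w∼v with V″⁻ (e⊆V″ w∈e)
          ...   | inj₁ w∈H₀ = ⊥-elim (Sⱼ-opposite v∈Sⱼ (trans (sym w∼v) (H₀-side-a₀ a₀∼b₀ w∈H₀)))
          ...   | inj₂ (i , w∈Sᵢ , actᵢ) =
            count-∧-< {P = P} (F i i₀) (F-crosses-from-opposite a₀∼b₀ actᵢ Sᵢ-opposite i₀)
                      (trans (cong (E (F i i₀) ∧_) (dec-false (nonempty? (F i i₀ ∩ S j)) F∩Sⱼ≡∅)) (∧-zeroʳ _))
            where
            Sᵢ-opposite : ∀ {z′} → z′ ∈ S i → side z′ ≢ side a₀
            Sᵢ-opposite z′∈Sᵢ = Sⱼ-opposite v∈Sⱼ ∘ trans (sym w∼v) ∘ trans (S-mono i actᵢ w∈Sᵢ z′∈Sᵢ)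
            F∩Sⱼ≡∅ : Empty (F i i₀ ∩ S j)
            F∩Sⱼ≡∅ (x , x∈F∩Sⱼ) with x∈p∩q⁻ (F i i₀) (S j) x∈F∩Sⱼ
            ... | x∈F , x∈Sⱼ with F⊆S∪H₀ i i₀ x∈F
            ...   | inj₂ x∈H₀ = S∉H₀ j x∈Sⱼ x∈H₀
            ...   | inj₁ x∈Sᵢ with refl ← S-unique i j x∈Sᵢ x∈Sⱼ = w∉Sⱼ w∈Sᵢ

        all-monochrome : (∀ j → Active j → Monochrome (S j)) → suc k ≤ count Q
        all-monochrome S-mono with side a₀ ≟ᵇ side b₀
        ... | no a₀≁b₀  = A-B-split S-mono a₀≁b₀
        ... | yes a₀∼b₀ = H₀-mono S-mono a₀∼b₀

        cut-bound : suc k ≤ count Q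
        cut-bound with any? (λ j → nonempty? (e ∩ S j) ×-dec split? (S j))
        ... | yes (j , act , Sⱼ-split) = S-split j act Sⱼ-split
        ... | no no-split = all-monochrome λ j act → ¬Split⇒Monochrome (λ Sⱼ-split → no-split (j , act , Sⱼ-split))

      cut-bound : suc k ≤ count Q
      cut-bound with split? A | split? B
      ... | yes A-split | _           = large-split-block (H₀⊆V″ ∘ A⊆H₀) A-complete t<∣A∣ A-split
      ... | no _        | yes B-split = large-split-block (H₀⊆V″ ∘ B⊆H₀) B-complete t<∣B∣ B-split
      ... | no A-unsplit | no B-unsplit =
        MonochromeH₀.cut-bound (¬Split⇒Monochrome A-unsplit) (¬Split⇒Monochrome B-unsplit)

    κ'≥k+1 : κ'≥ V″ E″ (suc k)
    κ'≥k+1 X (X⊆V″ , (_ , x₀∈X) , (_ , y₀∈V″─X)) =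
      subst (suc k ≤_) (sym (d≡count-crossing V″ E″ X)) (Cut.cut-bound X X⊆V″ x₀∈X y₀∈V″─X)

  edgeMaximal : EdgeMaximal r k l E
  edgeMaximal = uniform , subhypergraph-κ'≤k ,
    λ e ∣e∣≡r e∉E → let open AddEdge e ∣e∣≡r e∉E in V″ , E″ , E″-sub , l≤∣V″∣ , κ'≥k+1

theorem4p4 :
    (k t r : ℕ) → r < t → 2 < r → k ≡ (t ∸ 1) C (r ∸ 1) → 2 * t ≤ k * r →
    (n l p : ℕ) → n ≡ l + p * t → 2 * t + 2 ≤ l →
    -- vertex classes of H on Fin n
    (A B : Subset n) (S : Fin p → Subset n) →
    ∣ A ∣ ≡ ⌈ l /2⌉ → ∣ B ∣ ≡ ⌊ l /2⌋ → (∀ j → ∣ S j ∣ ≡ t) →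
    (∀ v → v ∈ A → v ∉ B) →
    (∀ j v → v ∈ S j → v ∉ A × v ∉ B) →
    (∀ i j v → i ≢ j → v ∈ S i → v ∉ S j) →
    (∀ v → v ∈ A ⊎ v ∈ B ⊎ ∃ λ j → v ∈ S j) →
    -- the k edges between A and B
    (F₀ : Fin k → Subset n) → Injective _≡_ _≡_ F₀ →
    (∀ i → ∣ F₀ i ∣ ≡ r × F₀ i ⊆ A ∪ B × Nonempty (F₀ i ∩ A) × Nonempty (F₀ i ∩ B)) →
    -- the k edges between S_j and H₀
    (F : Fin p → Fin k → Subset n) → (∀ j → Injective _≡_ _≡_ (F j)) →
    (∀ j i → ∣ F j i ∣ ≡ r × F j i ⊆ S j ∪ (A ∪ B)
             × Nonempty (F j i ∩ S j) × Nonempty (F j i ∩ (A ∪ B))) →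
    (∀ j v → v ∈ S j → ∃ λ i → v ∈ F j i) →
    (∀ j → (∃ λ i → Nonempty (F j i ∩ A)) × (∃ λ i → Nonempty (F j i ∩ B))) →
    -- the edge set of H
    (E : Edges n) →
    (∀ e → e ∈E E ⇔
       ((∣ e ∣ ≡ r × e ⊆ A) ⊎ (∣ e ∣ ≡ r × e ⊆ B) ⊎ (∃ λ j → ∣ e ∣ ≡ r × e ⊆ S j)
        ⊎ (∃ λ i → e ≡ F₀ i) ⊎ (∃₂ λ j i → e ≡ F j i))) →
    EdgeMaximal r k l E
theorem4p4 k t r r<t 2<r k≡ _ n l p _ 2t+2≤l A B S ∣A∣≡ ∣B∣≡ ∣S∣≡t A-B-disjoint S-outside-AB S-disjoint
           covered F₀ F₀-injective F₀-shape F F-injective F-shape F-covers F-meets-A-B E E-def =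
  Construction.edgeMaximal r<t 2<r k≡ 2t+2≤l ∣A∣≡ ∣B∣≡ ∣S∣≡t A-B-disjoint S-outside-AB S-disjoint covered
    F₀-injective F₀-shape F-injective F-shape F-covers F-meets-A-B E-def
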